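{- If $\Gamma\vdash C_r\rhd\Xi$ is derivable in implicit ordered adjoint natural deduction, then $\Gamma\vdash C_r\dashv\Omega$ is derivable in ordered adjoint natural deduction with explicit structural rules for every $\Omega\in\Xi$.
   Context: Modes and propositions. Fix a preorder $(\mathcal{M},\geq)$ of modes and, for each mode $m$, a set $\sigma(m)\subseteq\{\mathsf{W},\mathsf{C}^\leftarrow,\mathsf{C}^\rightarrow,\mathsf{M}^\leftarrow,\mathsf{M}^\rightarrow\}$, monotone ($k\geq m$ implies $\sigma(k)\supseteq\sigma(m)$), and satisfying: if $\mathsf{W},\mathsf{C}^\leftarrow\in\sigma(m)$ then $\mathsf{M}^\leftarrow\in\sigma(m)$; if $\mathsf{W},\mathsf{C}^\rightarrow\in\sigma(m)$ then $\mathsf{M}^\rightarrow\in\sigma(m)$. Propositions: $A_m ::= P_m \mid A_m \rightarrowtail B_m \mid A_m \twoheadrightarrow B_m \mid A_m \,\&\, B_m \mid {\uparrow}^m_l A_l\ (m\geq l) \mid A_m\bullet B_m \mid 1_m \mid A_m\oplus B_m \mid {\downarrow}^k_m A_k\ (k\geq m)$. An ordered context $\Omega$ is a finite sequence of labeled hypotheses $x{:}A_m$ (repetitions allowed, same variable always same proposition); $|\Omega|$ its variable set; $\Omega\geq m$ means all its hypotheses $y{:}B_k$ have $k\geq m$; $\Omega$ is normal if no variable repeats. Explicit natural deduction $\Gamma\vdash A_m\dashv\Omega$ ($\Gamma$ unordered set of hypotheses, $\Omega$ ordered used hypotheses). Rules: (hyp) $x{:}A_m\in\Gamma\Rightarrow\Gamma\vdash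 A_m\dashv(x{:}A_m)$; ($1I$) $\Rightarrow\Gamma\vdash1_m\dashv\cdot$; ($1E$) $\Gamma\vdash1_m\dashv\Omega_M$, $m\geq r$, $\Gamma\vdash C_r\dashv\Omega_L\Omega_R\Rightarrow\Gamma\vdash C_r\dashv\Omega_L\Omega_M\Omega_R$; ($\bullet I$) $\Gamma\vdash A_m\dashv\Omega_L,\Gamma\vdash B_m\dashv\Omega_R\Rightarrow\Gamma\vdash A_m\bullet B_m\dashv\Omega_L\Omega_R$; ($\bullet E$) $\Gamma\vdash A_m\bullet B_m\dashv\Omega_M$, $m\geq r$, $x,y\notin|\Omega_L\Omega_R|$, $\Gamma,x{:}A_m,y{:}B_m\vdash C_r\dashv\Omega_L(x{:}A_m)(y{:}B_m)\Omega_R\Rightarrow\Gamma\vdash C_r\dashv\Omega_L\Omega_M\Omega_R$; ($\oplus I_i$) $\Gamma\vdash A_m\dashv\Omega$ (resp. $B_m$) $\Rightarrow\Gamma\vdash A_m\oplus B_m\dashv\Omega$; ($\oplus E$) $\Gamma\vdash A_m\oplus B_m\dashv\Omega_M$, $m\geq r$, $x\notin|\Omega_L\Omega_R|$, $\Gamma,x{:}A_m\vdash C_r\dashv\Omega_L(x{:}A_m)\Omega_R$, $\Gamma,x{:}B_m\vdash C_r\dashv\Omega_L(x{:}B_m)\Omega_R\Rightarrow\Gamma\vdash C_r\dashv\Omega_L\Omega_M\Omega_R$; (${\downarrow}I$) $\Gamma\vdash A_k\dashv\Omega\Rightarrow\Gamma\vdash{\downarrow}^k_mA_k\dashv\Omega$;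 (${\downarrow}E$) $\Gamma\vdash{\downarrow}^k_mA_k\dashv\Omega_M$, $m\geq r$, $\Gamma,x{:}A_k\vdash C_r\dashv\Omega_L(x{:}A_k)\Omega_R$, $x\notin|\Omega_L\Omega_R|\Rightarrow\Gamma\vdash C_r\dashv\Omega_L\Omega_M\Omega_R$; ($\twoheadrightarrow I$) $\Gamma,x{:}A_m\vdash B_m\dashv\Omega(x{:}A_m)$, $x\notin|\Omega|\Rightarrow\Gamma\vdash A_m\twoheadrightarrow B_m\dashv\Omega$; ($\twoheadrightarrow E$) $\Gamma\vdash A_m\twoheadrightarrow B_m\dashv\Omega_L,\Gamma\vdash A_m\dashv\Omega_R\Rightarrow\Gamma\vdash B_m\dashv\Omega_L\Omega_R$; ($\rightarrowtail I$) $\Gamma,x{:}A_m\vdash B_m\dashv(x{:}A_m)\Omega$, $x\notin|\Omega|\Rightarrow\Gamma\vdash A_m\rightarrowtail B_m\dashv\Omega$; ($\rightarrowtail E$) $\Gamma\vdash A_m\rightarrowtail B_m\dashv\Omega_R,\Gamma\vdash A_m\dashv\Omega_L\Rightarrow\Gamma\vdash B_m\dashv\Omega_L\Omega_R$; ($\&I$) $\Gamma\vdash A_m\dashv\Omega,\Gamma\vdash B_m\dashv\Omega\Rightarrow\Gamma\vdash A_m\&B_m\dashv\Omega$; ($\&E_i$) $\Gamma\vdash A_m\&B_m\dashv\Omega\Rightarrow\Gamma\vdash A_m\dashv\Omega$ (resp. $B_m$); (${\uparrow}I$) $\Gamma\vdash A_l\dashv\Omega$, $\Omega\geq m\Rightarrow\Gamma\vdash{\uparrow}^m_lA_l\dashv\Omega$;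 (${\uparrow}E$) $\Gamma\vdash{\uparrow}^l_kA_k\dashv\Omega\Rightarrow\Gamma\vdash A_k\dashv\Omega$; structural: ($\mathsf{W}$) $\Gamma\vdash C_r\dashv\Omega_L\Omega_R$, $x{:}A_m\in\Gamma$, $m\geq r$, $\mathsf{W}\in\sigma(m)\Rightarrow\Gamma\vdash C_r\dashv\Omega_L(x{:}A_m)\Omega_R$; ($\mathsf{C}^\rightarrow$) $\Gamma\vdash C_r\dashv\Omega_L(x{:}A_m)\Omega_M(x{:}A_m)\Omega_R$, $\mathsf{C}^\rightarrow\in\sigma(m)\Rightarrow\Gamma\vdash C_r\dashv\Omega_L\Omega_M(x{:}A_m)\Omega_R$; ($\mathsf{C}^\leftarrow$) same premise, $\mathsf{C}^\leftarrow\in\sigma(m)\Rightarrow\Gamma\vdash C_r\dashv\Omega_L(x{:}A_m)\Omega_M\Omega_R$; ($\mathsf{M}^\rightarrow$) $\Gamma\vdash C_r\dashv\Omega_L(x{:}A_m)\Omega_M\Omega_R$, $\mathsf{M}^\rightarrow\in\sigma(m)\Rightarrow\Gamma\vdash C_r\dashv\Omega_L\Omega_M(x{:}A_m)\Omega_R$; ($\mathsf{M}^\leftarrow$) $\Gamma\vdash C_r\dashv\Omega_L\Omega_M(x{:}A_m)\Omega_R$, $\mathsf{M}^\leftarrow\in\sigma(m)\Rightarrow\Gamma\vdash C_r\dashv\Omega_L(x{:}A_m)\Omega_M\Omega_R$. Context reduction $\Omega\leadsto^{\Gamma}_{r}\Omega'$: generated by (W) $\Omega_L(x{:}A_m)\Omega_R\leadsto\Omega'$,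 $\mathsf{W}\in\sigma(m)$, $m\geq r$, $x{:}A_m\in\Gamma$, $x\notin|\Omega_L\Omega_R|\Rightarrow\Omega_L\Omega_R\leadsto\Omega'$; ($\mathsf{C}^\leftarrow$) $\Omega_L(x{:}A_m)\Omega_M\Omega_R\leadsto\Omega'$, $\mathsf{C}^\leftarrow\in\sigma(m)\Rightarrow\Omega_L(x{:}A_m)\Omega_M(x{:}A_m)\Omega_R\leadsto\Omega'$; ($\mathsf{C}^\rightarrow$) $\Omega_L\Omega_M(x{:}A_m)\Omega_R\leadsto\Omega'$, $\mathsf{C}^\rightarrow\in\sigma(m)\Rightarrow\Omega_L(x{:}A_m)\Omega_M(x{:}A_m)\Omega_R\leadsto\Omega'$; ($\mathsf{M}^\leftarrow$) $\Omega_L(x{:}A_m)\Omega_M\Omega_R\leadsto\Omega'$, $\mathsf{M}^\leftarrow\in\sigma(m)\Rightarrow\Omega_L\Omega_M(x{:}A_m)\Omega_R\leadsto\Omega'$; ($\mathsf{M}^\rightarrow$) $\Omega_L\Omega_M(x{:}A_m)\Omega_R\leadsto\Omega'$, $\mathsf{M}^\rightarrow\in\sigma(m)\Rightarrow\Omega_L(x{:}A_m)\Omega_M\Omega_R\leadsto\Omega'$; (id) $\Omega$ normal $\Rightarrow\Omega\leadsto\Omega$. $\mathsf{NF}_{\Gamma,r}(\Omega)=\{\Omega'\mid\Omega\leadsto^{\Gamma}_{r}\Omega'\}$, extended to sets $\Xi$ of contexts by union. For sets of contexts, $\Xi_1\Xi_2=\{\Omega_1\Omega_2\mid\Omega_i\in\Xi_i\}$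 and $\Xi\Vert_m=\{\Omega\in\Xi\mid\Omega\geq m\}$. Implicit natural deduction: judgment $\Gamma\vdash A_m\rhd\Xi$, with $\Xi$ a set of normal contexts; a rule applies only if its output set is nonempty; $\mathsf{NF}$ without subscript means $\mathsf{NF}_{\Gamma,r}$ with $r$ the mode of the conclusion's proposition. Rules: (hyp) $x{:}A_m\in\Gamma\Rightarrow\Gamma\vdash A_m\rhd\mathsf{NF}(\{x{:}A_m\})$; ($1I$) $\Rightarrow\Gamma\vdash1_m\rhd\mathsf{NF}(\{\cdot\})$; ($1E$) $\Gamma\vdash1_m\rhd\Xi_M$, $m\geq r$, $\Gamma\vdash C_r\rhd\Xi'\Rightarrow\Gamma\vdash C_r\rhd\mathsf{NF}(\{\Omega_L\Omega_M\Omega_R\mid\Omega_L\Omega_R\in\Xi',\Omega_M\in\Xi_M\})$ (over all splittings); ($\bullet I$) $\Gamma\vdash A_m\rhd\Xi_L$, $\Gamma\vdash B_m\rhd\Xi_R\Rightarrow\Gamma\vdash A_m\bullet B_m\rhd\mathsf{NF}_{\Gamma,m}(\Xi_L\Xi_R)$; ($\bullet E$) $\Gamma\vdash A_m\bullet B_m\rhd\Xi_M$, $m\geq r$, $\Gamma,x{:}A_m,y{:}B_m\vdash C_r\rhd\Xi\Rightarrow\Gamma\vdash C_r\rhd\mathsf{NF}(\{\Omega_L\Omega_M\Omega_R\mid\Omega_L(x{:}A_m)(y{:}B_m)\Omega_R\in\Xi,\Omega_M\in\Xi_M\})$; ($\oplus I_i$) $\Gamma\vdash A_m\rhd\Xi$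 (resp. $B_m$) $\Rightarrow\Gamma\vdash A_m\oplus B_m\rhd\Xi$; ($\oplus E$) $\Gamma\vdash A_m\oplus B_m\rhd\Xi_M$, $m\geq r$, $\Gamma,x{:}A_m\vdash C_r\rhd\Xi_A$, $\Gamma,x{:}B_m\vdash C_r\rhd\Xi_B\Rightarrow\Gamma\vdash C_r\rhd\mathsf{NF}(\{\Omega_L\Omega_M\Omega_R\mid\Omega_L(x{:}A_m)\Omega_R\in\Xi_A,\Omega_L(x{:}B_m)\Omega_R\in\Xi_B,\Omega_M\in\Xi_M\})$; (${\downarrow}I$) $\Gamma\vdash A_l\rhd\Xi\Rightarrow\Gamma\vdash{\downarrow}^l_mA_l\rhd\mathsf{NF}_{\Gamma,m}(\Xi)$; (${\downarrow}E$) $\Gamma\vdash{\downarrow}^l_mA_l\rhd\Xi_M$, $m\geq r$, $\Gamma,x{:}A_l\vdash C_r\rhd\Xi\Rightarrow\Gamma\vdash C_r\rhd\mathsf{NF}_{\Gamma,r}(\{\Omega_L\Omega_M\Omega_R\mid\Omega_L(x{:}A_l)\Omega_R\in\Xi,\Omega_M\in\Xi_M\})$; ($\twoheadrightarrow I$) $\Gamma,x{:}A_m\vdash B_m\rhd\Xi'\Rightarrow\Gamma\vdash A_m\twoheadrightarrow B_m\rhd\{\Omega\mid\Omega(x{:}A_m)\in\Xi'\}$; ($\twoheadrightarrow E$) $\Gamma\vdash A_m\twoheadrightarrow B_m\rhd\Xi_L$, $\Gamma\vdash A_m\rhd\Xi_R\Rightarrow\Gamma\vdash B_m\rhd\mathsf{NF}(\Xi_L\Xi_R)$;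 ($\rightarrowtail I$) $\Gamma,x{:}A_m\vdash B_m\rhd\Xi'\Rightarrow\Gamma\vdash A_m\rightarrowtail B_m\rhd\{\Omega\mid(x{:}A_m)\Omega\in\Xi'\}$; ($\rightarrowtail E$) $\Gamma\vdash A_m\rightarrowtail B_m\rhd\Xi_R$, $\Gamma\vdash A_m\rhd\Xi_L\Rightarrow\Gamma\vdash B_m\rhd\mathsf{NF}(\Xi_L\Xi_R)$; ($\&I$) $\Gamma\vdash A_m\rhd\Xi_A$, $\Gamma\vdash B_m\rhd\Xi_B\Rightarrow\Gamma\vdash A_m\&B_m\rhd\Xi_A\cap\Xi_B$; ($\&E_i$) $\Gamma\vdash A_m\&B_m\rhd\Xi\Rightarrow\Gamma\vdash A_m\rhd\Xi$ (resp. $B_m$); (${\uparrow}I$) $\Gamma\vdash A_k\rhd\Xi\Rightarrow\Gamma\vdash{\uparrow}^m_kA_k\rhd\Xi\Vert_m$; (${\uparrow}E$) $\Gamma\vdash{\uparrow}^m_kA_k\rhd\Xi\Rightarrow\Gamma\vdash A_k\rhd\mathsf{NF}_{\Gamma,k}(\Xi)$. -}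

module Defs where

open import Data.Nat using (ℕ)
open import Data.List using (List; []; _∷_; _++_; [_]; map)
open import Data.List.Membership.Propositional using (_∈_; _∉_)
open import Data.List.Relation.Unary.All using (All)
open import Data.List.Relation.Unary.Unique.Propositional using (Unique)
open import Data.Product using (Σ; ∃; ∃₂; _×_; _,_)
open import Relation.Binary.PropositionalEquality using (_≡_)
open import Relation.Binary.Structures using (IsPreorder)

data Struct : Set where
  W C← C→ M← M→ : Struct

record ModeSystem : Set₁ where
  field
    Mode       : Set
    _≥_        : Mode → Mode → Set
    isPreorder : IsPreorder _≡_ _≥_
    _∈σ_       : Struct → Mode → Set
    σ-mono     : ∀ {k m s} → k ≥ m → s ∈σ m → s ∈σ k
    WC←⇒M←     : ∀ {m} → W ∈σ m → C← ∈σ m → M← ∈σ m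
    WC→⇒M→     : ∀ {m} → W ∈σ m → C→ ∈σ m → M→ ∈σ m

module ADJ (𝓜 : ModeSystem) where
  open ModeSystem 𝓜

  -- Propositions A_m, indexed by their mode.  The mode side conditions of
  -- the shifts are irrelevant (propositions do not depend on the proof).
  data Pr : Mode → Set where
    atom  : ∀ {m} → ℕ → Pr m
    _↣_   : ∀ {m} → Pr m → Pr m → Pr m
    _↠_   : ∀ {m} → Pr m → Pr m → Pr m
    _&_   : ∀ {m} → Pr m → Pr m → Pr m
    ↑     : ∀ {m l} → .(m ≥ l) → Pr l → Pr m
    _•_   : ∀ {m} → Pr m → Pr m → Pr m
    𝟙     : ∀ {m} → Pr m
    _⊕_   : ∀ {m} → Pr m → Pr m → Pr m
    ↓     : ∀ {k m} → .(k ≥ m) → Pr k → Pr m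

  Var : Set
  Var = ℕ

  data Hyp : Set where
    _∶_ : ∀ {m} → Var → Pr m → Hyp

  var : Hyp → Var
  var (x ∶ _) = x

  modeOf : Hyp → Mode
  modeOf (_∶_ {m} _ _) = m

  -- ordered contexts Ω (and Γ, used as a set via membership)
  Ctx : Set
  Ctx = List Hyp

  vars : Ctx → List Var
  vars = map var

  _≥ᶜ_ : Ctx → Mode → Set
  Ω ≥ᶜ m = All (λ h → modeOf h ≥ m) Ω

  Normal : Ctx → Set
  Normal Ω = Unique (vars Ω)

  data _⊢_⊣_ : Ctx → ∀ {m} → Pr m → Ctx → Set where
    hyp : ∀ {Γ m x} {A : Pr m} → (x ∶ A) ∈ Γ → Γ ⊢ A ⊣ [ x ∶ A ]
    1I  : ∀ {Γ m} → Γ ⊢ 𝟙 {m} ⊣ []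
    1E  : ∀ {Γ m r} {C : Pr r} {ΩL ΩM ΩR} →
          Γ ⊢ 𝟙 {m} ⊣ ΩM → m ≥ r → Γ ⊢ C ⊣ (ΩL ++ ΩR) →
          Γ ⊢ C ⊣ (ΩL ++ ΩM ++ ΩR)
    •I  : ∀ {Γ m} {A B : Pr m} {ΩL ΩR} →
          Γ ⊢ A ⊣ ΩL → Γ ⊢ B ⊣ ΩR → Γ ⊢ A • B ⊣ (ΩL ++ ΩR)
    •E  : ∀ {Γ m r} {A B : Pr m} {C : Pr r} {ΩL ΩM ΩR x y} →
          Γ ⊢ A • B ⊣ ΩM → m ≥ r →
          x ∉ vars Γ → y ∉ vars ((x ∶ A) ∷ Γ) →
          x ∉ vars (ΩL ++ ΩR) → y ∉ vars (ΩL ++ ΩR) →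
          ((y ∶ B) ∷ (x ∶ A) ∷ Γ) ⊢ C ⊣ (ΩL ++ (x ∶ A) ∷ (y ∶ B) ∷ ΩR) →
          Γ ⊢ C ⊣ (ΩL ++ ΩM ++ ΩR)
    ⊕I₁ : ∀ {Γ m} {A B : Pr m} {Ω} → Γ ⊢ A ⊣ Ω → Γ ⊢ A ⊕ B ⊣ Ω
    ⊕I₂ : ∀ {Γ m} {A B : Pr m} {Ω} → Γ ⊢ B ⊣ Ω → Γ ⊢ A ⊕ B ⊣ Ω
    ⊕E  : ∀ {Γ m r} {A B : Pr m} {C : Pr r} {ΩL ΩM ΩR x} →
          Γ ⊢ A ⊕ B ⊣ ΩM → m ≥ r → x ∉ vars Γ → x ∉ vars (ΩL ++ ΩR) →
          ((x ∶ A) ∷ Γ) ⊢ C ⊣ (ΩL ++ (x ∶ A) ∷ ΩR) →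
          ((x ∶ B) ∷ Γ) ⊢ C ⊣ (ΩL ++ (x ∶ B) ∷ ΩR) →
          Γ ⊢ C ⊣ (ΩL ++ ΩM ++ ΩR)
    ↓I  : ∀ {Γ k m} {A : Pr k} {Ω} .(p : k ≥ m) →
          Γ ⊢ A ⊣ Ω → Γ ⊢ ↓ {k} {m} p A ⊣ Ω
    ↓E  : ∀ {Γ k m r} {A : Pr k} {C : Pr r} {ΩL ΩM ΩR x} .(p : k ≥ m) →
          Γ ⊢ ↓ {k} {m} p A ⊣ ΩM → m ≥ r →
          x ∉ vars Γ → x ∉ vars (ΩL ++ ΩR) →
          ((x ∶ A) ∷ Γ) ⊢ C ⊣ (ΩL ++ (x ∶ A) ∷ ΩR) →
          Γ ⊢ C ⊣ (ΩL ++ ΩM ++ ΩR)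
    ↠I  : ∀ {Γ m} {A B : Pr m} {Ω x} → x ∉ vars Γ → x ∉ vars Ω →
          ((x ∶ A) ∷ Γ) ⊢ B ⊣ (Ω ++ [ x ∶ A ]) → Γ ⊢ A ↠ B ⊣ Ω
    ↠E  : ∀ {Γ m} {A B : Pr m} {ΩL ΩR} →
          Γ ⊢ A ↠ B ⊣ ΩL → Γ ⊢ A ⊣ ΩR → Γ ⊢ B ⊣ (ΩL ++ ΩR)
    ↣I  : ∀ {Γ m} {A B : Pr m} {Ω x} → x ∉ vars Γ → x ∉ vars Ω →
          ((x ∶ A) ∷ Γ) ⊢ B ⊣ ((x ∶ A) ∷ Ω) → Γ ⊢ A ↣ B ⊣ Ω
    ↣E  : ∀ {Γ m} {A B : Pr m} {ΩL ΩR} →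
          Γ ⊢ A ↣ B ⊣ ΩR → Γ ⊢ A ⊣ ΩL → Γ ⊢ B ⊣ (ΩL ++ ΩR)
    &I  : ∀ {Γ m} {A B : Pr m} {Ω} →
          Γ ⊢ A ⊣ Ω → Γ ⊢ B ⊣ Ω → Γ ⊢ A & B ⊣ Ω
    &E₁ : ∀ {Γ m} {A B : Pr m} {Ω} → Γ ⊢ A & B ⊣ Ω → Γ ⊢ A ⊣ Ω
    &E₂ : ∀ {Γ m} {A B : Pr m} {Ω} → Γ ⊢ A & B ⊣ Ω → Γ ⊢ B ⊣ Ω
    ↑I  : ∀ {Γ m l} {A : Pr l} {Ω} .(p : m ≥ l) →
          Γ ⊢ A ⊣ Ω → Ω ≥ᶜ m → Γ ⊢ ↑ {m} {l} p A ⊣ Ω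
    ↑E  : ∀ {Γ l k} {A : Pr k} {Ω} .(p : l ≥ k) →
          Γ ⊢ ↑ {l} {k} p A ⊣ Ω → Γ ⊢ A ⊣ Ω
    sW  : ∀ {Γ r m} {C : Pr r} {A : Pr m} {ΩL ΩR x} →
          Γ ⊢ C ⊣ (ΩL ++ ΩR) → (x ∶ A) ∈ Γ → m ≥ r → W ∈σ m →
          Γ ⊢ C ⊣ (ΩL ++ (x ∶ A) ∷ ΩR)
    sC→ : ∀ {Γ r m} {C : Pr r} {A : Pr m} {ΩL ΩM ΩR x} →
          Γ ⊢ C ⊣ (ΩL ++ (x ∶ A) ∷ ΩM ++ (x ∶ A) ∷ ΩR) → C→ ∈σ m →
          Γ ⊢ C ⊣ (ΩL ++ ΩM ++ (x ∶ A) ∷ ΩR)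
    sC← : ∀ {Γ r m} {C : Pr r} {A : Pr m} {ΩL ΩM ΩR x} →
          Γ ⊢ C ⊣ (ΩL ++ (x ∶ A) ∷ ΩM ++ (x ∶ A) ∷ ΩR) → C← ∈σ m →
          Γ ⊢ C ⊣ (ΩL ++ (x ∶ A) ∷ ΩM ++ ΩR)
    sM→ : ∀ {Γ r m} {C : Pr r} {A : Pr m} {ΩL ΩM ΩR x} →
          Γ ⊢ C ⊣ (ΩL ++ (x ∶ A) ∷ ΩM ++ ΩR) → M→ ∈σ m →
          Γ ⊢ C ⊣ (ΩL ++ ΩM ++ (x ∶ A) ∷ ΩR)
    sM← : ∀ {Γ r m} {C : Pr r} {A : Pr m} {ΩL ΩM ΩR x} →
          Γ ⊢ C ⊣ (ΩL ++ ΩM ++ (x ∶ A) ∷ ΩR) → M← ∈σ m →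
          Γ ⊢ C ⊣ (ΩL ++ (x ∶ A) ∷ ΩM ++ ΩR)

  data _⇝[_,_]_ : Ctx → Ctx → Mode → Ctx → Set where
    rW  : ∀ {Γ r m} {A : Pr m} {ΩL ΩR Ω' x} →
          (ΩL ++ (x ∶ A) ∷ ΩR) ⇝[ Γ , r ] Ω' → W ∈σ m → m ≥ r →
          (x ∶ A) ∈ Γ → x ∉ vars (ΩL ++ ΩR) →
          (ΩL ++ ΩR) ⇝[ Γ , r ] Ω'
    rC← : ∀ {Γ r m} {A : Pr m} {ΩL ΩM ΩR Ω' x} →
          (ΩL ++ (x ∶ A) ∷ ΩM ++ ΩR) ⇝[ Γ , r ] Ω' → C← ∈σ m →
          (ΩL ++ (x ∶ A) ∷ ΩM ++ (x ∶ A) ∷ ΩR) ⇝[ Γ , r ] Ω'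
    rC→ : ∀ {Γ r m} {A : Pr m} {ΩL ΩM ΩR Ω' x} →
          (ΩL ++ ΩM ++ (x ∶ A) ∷ ΩR) ⇝[ Γ , r ] Ω' → C→ ∈σ m →
          (ΩL ++ (x ∶ A) ∷ ΩM ++ (x ∶ A) ∷ ΩR) ⇝[ Γ , r ] Ω'
    rM← : ∀ {Γ r m} {A : Pr m} {ΩL ΩM ΩR Ω' x} →
          (ΩL ++ (x ∶ A) ∷ ΩM ++ ΩR) ⇝[ Γ , r ] Ω' → M← ∈σ m →
          (ΩL ++ ΩM ++ (x ∶ A) ∷ ΩR) ⇝[ Γ , r ] Ω'
    rM→ : ∀ {Γ r m} {A : Pr m} {ΩL ΩM ΩR Ω' x} →
          (ΩL ++ ΩM ++ (x ∶ A) ∷ ΩR) ⇝[ Γ , r ] Ω' → M→ ∈σ m →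
          (ΩL ++ (x ∶ A) ∷ ΩM ++ ΩR) ⇝[ Γ , r ] Ω'
    rid : ∀ {Γ r Ω} → Normal Ω → Ω ⇝[ Γ , r ] Ω

  CtxSet : Set₁
  CtxSet = Ctx → Set

  NonEmpty : CtxSet → Set
  NonEmpty Ξ = ∃ Ξ

  ⟦_⟧ : Ctx → CtxSet
  ⟦ Ω₀ ⟧ Ω = Ω ≡ Ω₀

  _⊗_ : CtxSet → CtxSet → CtxSet
  (Ξ₁ ⊗ Ξ₂) Ω = ∃₂ λ Ω₁ Ω₂ → Ω ≡ Ω₁ ++ Ω₂ × Ξ₁ Ω₁ × Ξ₂ Ω₂

  _∥_ : CtxSet → Mode → CtxSet
  (Ξ ∥ m) Ω = Ξ Ω × Ω ≥ᶜ m

  NF : Ctx → Mode → CtxSet → CtxSet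
  NF Γ r Ξ Ω' = ∃ λ Ω → Ξ Ω × Ω ⇝[ Γ , r ] Ω'

  data _⊢_▷_ : Ctx → ∀ {m} → Pr m → CtxSet → Set₁ where
    hyp : ∀ {Γ m x} {A : Pr m} → (x ∶ A) ∈ Γ →
          NonEmpty (NF Γ m ⟦ [ x ∶ A ] ⟧) →
          Γ ⊢ A ▷ NF Γ m ⟦ [ x ∶ A ] ⟧
    1I  : ∀ {Γ m} → NonEmpty (NF Γ m ⟦ [] ⟧) → Γ ⊢ 𝟙 {m} ▷ NF Γ m ⟦ [] ⟧
    1E  : ∀ {Γ m r} {C : Pr r} {ΞM Ξ'} →
          Γ ⊢ 𝟙 {m} ▷ ΞM → m ≥ r → Γ ⊢ C ▷ Ξ' →
          let Ξ = NF Γ r (λ Ω → Σ Ctx λ ΩL → Σ Ctx λ ΩM → Σ Ctx λ ΩR →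
                    Ω ≡ ΩL ++ ΩM ++ ΩR × Ξ' (ΩL ++ ΩR) × ΞM ΩM) in
          NonEmpty Ξ → Γ ⊢ C ▷ Ξ
    •I  : ∀ {Γ m} {A B : Pr m} {ΞL ΞR} →
          Γ ⊢ A ▷ ΞL → Γ ⊢ B ▷ ΞR → NonEmpty (NF Γ m (ΞL ⊗ ΞR)) →
          Γ ⊢ A • B ▷ NF Γ m (ΞL ⊗ ΞR)
    •E  : ∀ {Γ m r} {A B : Pr m} {C : Pr r} {ΞM Ξ' x y} →
          Γ ⊢ A • B ▷ ΞM → m ≥ r →
          x ∉ vars Γ → y ∉ vars ((x ∶ A) ∷ Γ) →
          ((y ∶ B) ∷ (x ∶ A) ∷ Γ) ⊢ C ▷ Ξ' →
          let Ξ = NF Γ r (λ Ω → Σ Ctx λ ΩL → Σ Ctx λ ΩM → Σ Ctx λ ΩR →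
                    Ω ≡ ΩL ++ ΩM ++ ΩR ×
                    Ξ' (ΩL ++ (x ∶ A) ∷ (y ∶ B) ∷ ΩR) × ΞM ΩM) in
          NonEmpty Ξ → Γ ⊢ C ▷ Ξ
    ⊕I₁ : ∀ {Γ m} {A B : Pr m} {Ξ} → Γ ⊢ A ▷ Ξ → NonEmpty Ξ → Γ ⊢ A ⊕ B ▷ Ξ
    ⊕I₂ : ∀ {Γ m} {A B : Pr m} {Ξ} → Γ ⊢ B ▷ Ξ → NonEmpty Ξ → Γ ⊢ A ⊕ B ▷ Ξ
    ⊕E  : ∀ {Γ m r} {A B : Pr m} {C : Pr r} {ΞM ΞA ΞB x} →
          Γ ⊢ A ⊕ B ▷ ΞM → m ≥ r → x ∉ vars Γ →
          ((x ∶ A) ∷ Γ) ⊢ C ▷ ΞA → ((x ∶ B) ∷ Γ) ⊢ C ▷ ΞB →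
          let Ξ = NF Γ r (λ Ω → Σ Ctx λ ΩL → Σ Ctx λ ΩM → Σ Ctx λ ΩR →
                    Ω ≡ ΩL ++ ΩM ++ ΩR × ΞA (ΩL ++ (x ∶ A) ∷ ΩR) ×
                    ΞB (ΩL ++ (x ∶ B) ∷ ΩR) × ΞM ΩM) in
          NonEmpty Ξ → Γ ⊢ C ▷ Ξ
    ↓I  : ∀ {Γ l m} {A : Pr l} {Ξ} .(p : l ≥ m) →
          Γ ⊢ A ▷ Ξ → NonEmpty (NF Γ m Ξ) → Γ ⊢ ↓ {l} {m} p A ▷ NF Γ m Ξ
    ↓E  : ∀ {Γ l m r} {A : Pr l} {C : Pr r} {ΞM Ξ' x} .(p : l ≥ m) →
          Γ ⊢ ↓ {l} {m} p A ▷ ΞM → m ≥ r → x ∉ vars Γ →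
          ((x ∶ A) ∷ Γ) ⊢ C ▷ Ξ' →
          let Ξ = NF Γ r (λ Ω → Σ Ctx λ ΩL → Σ Ctx λ ΩM → Σ Ctx λ ΩR →
                    Ω ≡ ΩL ++ ΩM ++ ΩR × Ξ' (ΩL ++ (x ∶ A) ∷ ΩR) × ΞM ΩM) in
          NonEmpty Ξ → Γ ⊢ C ▷ Ξ
    ↠I  : ∀ {Γ m} {A B : Pr m} {Ξ' x} → x ∉ vars Γ →
          ((x ∶ A) ∷ Γ) ⊢ B ▷ Ξ' →
          NonEmpty (λ Ω → Ξ' (Ω ++ [ x ∶ A ])) →
          Γ ⊢ A ↠ B ▷ (λ Ω → Ξ' (Ω ++ [ x ∶ A ]))
    ↠E  : ∀ {Γ m} {A B : Pr m} {ΞL ΞR} →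
          Γ ⊢ A ↠ B ▷ ΞL → Γ ⊢ A ▷ ΞR → NonEmpty (NF Γ m (ΞL ⊗ ΞR)) →
          Γ ⊢ B ▷ NF Γ m (ΞL ⊗ ΞR)
    ↣I  : ∀ {Γ m} {A B : Pr m} {Ξ' x} → x ∉ vars Γ →
          ((x ∶ A) ∷ Γ) ⊢ B ▷ Ξ' →
          NonEmpty (λ Ω → Ξ' ((x ∶ A) ∷ Ω)) →
          Γ ⊢ A ↣ B ▷ (λ Ω → Ξ' ((x ∶ A) ∷ Ω))
    ↣E  : ∀ {Γ m} {A B : Pr m} {ΞL ΞR} →
          Γ ⊢ A ↣ B ▷ ΞR → Γ ⊢ A ▷ ΞL → NonEmpty (NF Γ m (ΞL ⊗ ΞR)) →
          Γ ⊢ B ▷ NF Γ m (ΞL ⊗ ΞR)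
    &I  : ∀ {Γ m} {A B : Pr m} {ΞA ΞB} →
          Γ ⊢ A ▷ ΞA → Γ ⊢ B ▷ ΞB → NonEmpty (λ Ω → ΞA Ω × ΞB Ω) →
          Γ ⊢ A & B ▷ (λ Ω → ΞA Ω × ΞB Ω)
    &E₁ : ∀ {Γ m} {A B : Pr m} {Ξ} → Γ ⊢ A & B ▷ Ξ → NonEmpty Ξ → Γ ⊢ A ▷ Ξ
    &E₂ : ∀ {Γ m} {A B : Pr m} {Ξ} → Γ ⊢ A & B ▷ Ξ → NonEmpty Ξ → Γ ⊢ B ▷ Ξ
    ↑I  : ∀ {Γ m k} {A : Pr k} {Ξ} .(p : m ≥ k) →
          Γ ⊢ A ▷ Ξ → NonEmpty (Ξ ∥ m) → Γ ⊢ ↑ {m} {k} p A ▷ (Ξ ∥ m)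
    ↑E  : ∀ {Γ m k} {A : Pr k} {Ξ} .(p : m ≥ k) →
          Γ ⊢ ↑ {m} {k} p A ▷ Ξ → NonEmpty (NF Γ k Ξ) → Γ ⊢ A ▷ NF Γ k Ξ

-- Every rule of the implicit system is an explicit rule applied to one
-- member of each premise's output set, followed by a reduction to normal
-- form; and each reduction step ⇝ is read backwards as the corresponding
-- explicit structural rule. The freshness side conditions that the explicit
-- rules demand of ΩL ΩR hold because every output context is normal, so a
-- bound variable occurring in it cannot also occur in ΩL or ΩR.
module Submission where

open import Defs
open import Data.List using (List; []; _∷_; _++_)
open import Data.List.Properties using (++-identityʳ)
open import Data.List.Membership.Propositional using (_∉_)
open import Data.List.Membership.Propositional.Properties using (∈-map⁺; ∈-++⁺ʳ)
open import Data.List.Relation.Binary.Sublist.Propositional using (_⊆_; []; _∷_; _∷ʳ_; ⊆-refl)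
open import Data.List.Relation.Binary.Sublist.Propositional.Properties
  using (All-resp-⊆; map⁺; ++⁺; ++⁺ʳ)
open import Data.List.Relation.Unary.All using (lookup)
open import Data.List.Relation.Unary.All.Properties using (All¬⇒¬Any)
open import Data.List.Relation.Unary.Any using (here; there)
open import Data.List.Relation.Unary.AllPairs using ([]; _∷_)
open import Data.List.Relation.Unary.Unique.Propositional using (Unique)
open import Data.List.Relation.Unary.Unique.Propositional.Properties
  using (Unique[x∷xs]⇒x∉xs)
open import Data.Product using (_×_; _,_; proj₁; proj₂)
open import Relation.Binary.PropositionalEquality using (refl; sym; subst)

Unique-resp-⊇ : ∀ {a} {A : Set a} {xs ys : List A} → xs ⊆ ys → Unique ys → Unique xs
Unique-resp-⊇ []         []      = []
Unique-resp-⊇ (_ ∷ʳ τ)   (_ ∷ u) = Unique-resp-⊇ τ u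
Unique-resp-⊇ (refl ∷ τ) (p ∷ u) = All-resp-⊆ τ p ∷ Unique-resp-⊇ τ u

module Soundness (𝓜 : ModeSystem) where
  open ADJ 𝓜

  Normal-resp-⊇ : ∀ {Ω Ω'} → Ω ⊆ Ω' → Normal Ω' → Normal Ω
  Normal-resp-⊇ τ = Unique-resp-⊇ (map⁺ var τ)

  Normal⇒var∉ : ∀ ΩL {h ΩR} → Normal (ΩL ++ h ∷ ΩR) → var h ∉ vars (ΩL ++ ΩR)
  Normal⇒var∉ []       (h∉ΩR ∷ _) = All¬⇒¬Any h∉ΩR
  Normal⇒var∉ (_ ∷ ΩL) (g∉ ∷ _) (here h≡g) =
    lookup g∉ (∈-map⁺ var (∈-++⁺ʳ ΩL (here refl))) (sym h≡g)
  Normal⇒var∉ (_ ∷ ΩL) (_ ∷ u) (there h∈) = Normal⇒var∉ ΩL u h∈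

  Normal⇒vars∉ : ∀ ΩL {g h ΩR} → Normal (ΩL ++ g ∷ h ∷ ΩR) →
                 (var g ∉ vars (ΩL ++ ΩR)) × (var h ∉ vars (ΩL ++ ΩR))
  Normal⇒vars∉ ΩL u =
      Normal⇒var∉ ΩL (Normal-resp-⊇ (++⁺ (⊆-refl {x = ΩL}) (refl ∷ (_ ∷ʳ ⊆-refl))) u)
    , Normal⇒var∉ ΩL (Normal-resp-⊇ (++⁺ (⊆-refl {x = ΩL}) (_ ∷ʳ ⊆-refl)) u)

  ⇝-normal : ∀ {Γ r Ω Ω'} → Ω ⇝[ Γ , r ] Ω' → Normal Ω'
  ⇝-normal (rW ρ _ _ _ _) = ⇝-normal ρ
  ⇝-normal (rC← ρ _)      = ⇝-normal ρ
  ⇝-normal (rC→ ρ _)      = ⇝-normal ρ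
  ⇝-normal (rM← ρ _)      = ⇝-normal ρ
  ⇝-normal (rM→ ρ _)      = ⇝-normal ρ
  ⇝-normal (rid n)        = n

  NF-normal : ∀ {Γ r Ξ Ω} → NF Γ r Ξ Ω → Normal Ω
  NF-normal (_ , _ , ρ) = ⇝-normal ρ

  ⊣-resp-⇝ : ∀ {Γ r} {C : Pr r} {Ω Ω'} → Γ ⊢ C ⊣ Ω → Ω ⇝[ Γ , r ] Ω' → Γ ⊢ C ⊣ Ω'
  ⊣-resp-⇝ d (rW ρ w m≥r x∈Γ _) = ⊣-resp-⇝ (sW d x∈Γ m≥r w) ρ
  ⊣-resp-⇝ d (rC← ρ c)          = ⊣-resp-⇝ (sC← d c) ρ
  ⊣-resp-⇝ d (rC→ ρ c)          = ⊣-resp-⇝ (sC→ d c) ρ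
  ⊣-resp-⇝ d (rM← ρ m)          = ⊣-resp-⇝ (sM← d m) ρ
  ⊣-resp-⇝ d (rM→ ρ m)          = ⊣-resp-⇝ (sM→ d m) ρ
  ⊣-resp-⇝ d (rid _)            = d

  ▷-normal : ∀ {Γ r} {C : Pr r} {Ξ} → Γ ⊢ C ▷ Ξ → ∀ {Ω} → Ξ Ω → Normal Ω
  ▷-normal (hyp _ _) o = NF-normal o
  ▷-normal (1I _) o = NF-normal o
  ▷-normal (1E _ _ _ _) o = NF-normal o
  ▷-normal (•I _ _ _) o = NF-normal o
  ▷-normal (•E _ _ _ _ _ _) o = NF-normal o
  ▷-normal (⊕I₁ d _) o = ▷-normal d o
  ▷-normal (⊕I₂ d _) o = ▷-normal d o
  ▷-normal (⊕E _ _ _ _ _ _) o = NF-normal o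
  ▷-normal (↓I _ _ _) o = NF-normal o
  ▷-normal (↓E _ _ _ _ _ _) o = NF-normal o
  ▷-normal (↠I _ d _) {Ω} o = Normal-resp-⊇ (++⁺ʳ _ (⊆-refl {x = Ω})) (▷-normal d o)
  ▷-normal (↠E _ _ _) o = NF-normal o
  ▷-normal (↣I {A = A} {x = x} _ d _) o = Normal-resp-⊇ ((x ∶ A) ∷ʳ ⊆-refl) (▷-normal d o)
  ▷-normal (↣E _ _ _) o = NF-normal o
  ▷-normal (&I d _ _) (o , _) = ▷-normal d o
  ▷-normal (&E₁ d _) o = ▷-normal d o
  ▷-normal (&E₂ d _) o = ▷-normal d o
  ▷-normal (↑I _ d _) (o , _) = ▷-normal d o
  ▷-normal (↑E _ _ _) o = NF-normal o

  ▷⇒⊣ : ∀ {Γ r} {C : Pr r} {Ξ} → Γ ⊢ C ▷ Ξ → ∀ {Ω} → Ξ Ω → Γ ⊢ C ⊣ Ω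
  ▷⇒⊣ (hyp x∈Γ _) (_ , refl , ρ) = ⊣-resp-⇝ (hyp x∈Γ) ρ
  ▷⇒⊣ (1I _) (_ , refl , ρ) = ⊣-resp-⇝ 1I ρ
  ▷⇒⊣ (1E d𝟙 m≥r d _) (_ , (ΩL , _ , _ , refl , o , o𝟙) , ρ) =
    ⊣-resp-⇝ (1E {ΩL = ΩL} (▷⇒⊣ d𝟙 o𝟙) m≥r (▷⇒⊣ d o)) ρ
  ▷⇒⊣ (•I dA dB _) (_ , (_ , _ , refl , oA , oB) , ρ) =
    ⊣-resp-⇝ (•I (▷⇒⊣ dA oA) (▷⇒⊣ dB oB)) ρ
  ▷⇒⊣ (•E d• m≥r x∉Γ y∉Γ d _) (_ , (ΩL , _ , _ , refl , o , o•) , ρ) =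
    ⊣-resp-⇝ (•E {ΩL = ΩL} (▷⇒⊣ d• o•) m≥r x∉Γ y∉Γ (proj₁ fresh) (proj₂ fresh) (▷⇒⊣ d o)) ρ
    where fresh = Normal⇒vars∉ ΩL (▷-normal d o)
  ▷⇒⊣ (⊕I₁ d _) o = ⊕I₁ (▷⇒⊣ d o)
  ▷⇒⊣ (⊕I₂ d _) o = ⊕I₂ (▷⇒⊣ d o)
  ▷⇒⊣ (⊕E d⊕ m≥r x∉Γ dA dB _) (_ , (ΩL , _ , _ , refl , oA , oB , o⊕) , ρ) =
    ⊣-resp-⇝ (⊕E {ΩL = ΩL} (▷⇒⊣ d⊕ o⊕) m≥r x∉Γ (Normal⇒var∉ ΩL (▷-normal dA oA))
                (▷⇒⊣ dA oA) (▷⇒⊣ dB oB)) ρ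
  ▷⇒⊣ (↓I p d _) (_ , o , ρ) = ⊣-resp-⇝ (↓I p (▷⇒⊣ d o)) ρ
  ▷⇒⊣ (↓E p d↓ m≥r x∉Γ d _) (_ , (ΩL , _ , _ , refl , o , o↓) , ρ) =
    ⊣-resp-⇝ (↓E {ΩL = ΩL} p (▷⇒⊣ d↓ o↓) m≥r x∉Γ (Normal⇒var∉ ΩL (▷-normal d o))
                (▷⇒⊣ d o)) ρ
  ▷⇒⊣ (↠I {x = x} x∉Γ d _) {Ω} o =
    ↠I x∉Γ (subst (λ Δ → x ∉ vars Δ) (++-identityʳ Ω) (Normal⇒var∉ Ω (▷-normal d o)))
       (▷⇒⊣ d o)
  ▷⇒⊣ (↠E dL dR _) (_ , (_ , _ , refl , oL , oR) , ρ) =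
    ⊣-resp-⇝ (↠E (▷⇒⊣ dL oL) (▷⇒⊣ dR oR)) ρ
  ▷⇒⊣ (↣I x∉Γ d _) o = ↣I x∉Γ (Unique[x∷xs]⇒x∉xs (▷-normal d o)) (▷⇒⊣ d o)
  ▷⇒⊣ (↣E dR dL _) (_ , (_ , _ , refl , oL , oR) , ρ) =
    ⊣-resp-⇝ (↣E (▷⇒⊣ dR oR) (▷⇒⊣ dL oL)) ρ
  ▷⇒⊣ (&I dA dB _) (oA , oB) = &I (▷⇒⊣ dA oA) (▷⇒⊣ dB oB)
  ▷⇒⊣ (&E₁ d _) o = &E₁ (▷⇒⊣ d o)
  ▷⇒⊣ (&E₂ d _) o = &E₂ (▷⇒⊣ d o)
  ▷⇒⊣ (↑I p d _) (o , o≥m) = ↑I p (▷⇒⊣ d o) o≥m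
  ▷⇒⊣ (↑E p d _) (_ , o , ρ) = ⊣-resp-⇝ (↑E p (▷⇒⊣ d o)) ρ

theorem8 : (𝓜 : ModeSystem) → let open ADJ 𝓜 in
           ∀ {Γ : Ctx} {r} {C : Pr r} {Ξ : CtxSet} →
           Γ ⊢ C ▷ Ξ → ∀ {Ω : Ctx} → Ξ Ω → Γ ⊢ C ⊣ Ω
theorem8 𝓜 = Soundness.▷⇒⊣ 𝓜
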